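{- Let $n=4k$ with $k\ge1$ an integer, and let $S$ be the symmetric table defined below. Scheduling the game between teams $i\neq j$ in round $S(i,j)$ gives a feasible schedule: for every team $i$, the values $S(i,j)$, $j\ne i$, are exactly the rounds $1,\dots,n-1$, each once.
   Context: Teams are $1,\dots,n$, rounds are $1,\dots,n-1$. For integers $a$ and $m\ge1$, $a \bmod m$ denotes the residue in $\{0,\dots,m-1\}$. Define $\pi_i(j)=1+((n+1-i-j)\bmod (n-1))$. The table $S(i,j)$ for $i<j$ is defined as follows (and $S(j,i):=S(i,j)$). (1) For odd $i\le n/2$: $S(i,j)=\pi_i(j)$ for $i<j<n$, and $S(i,n)=\pi_i(i)$. (2) For odd $i$ with $n/2<i\le n-3$: $S(i,j)=\pi_i(j)$ for $i+1<j<n$, $S(i,i+1)=\pi_i(i)$, and $S(i,n)=\pi_i(i+1)$. (3) $S(n-1,n)=3$. (4) For even $i$ and $j>i$: $S(i,j)=S(i-1,j+1)$ if $j$ is odd, and $S(i,j)=S(i-1,j-1)$ if $j$ is even. A schedule is feasible if every team plays exactly one game in every round. -}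

module Defs where

open import Data.Nat using (ℕ; zero; suc; _+_; _*_; _∸_; _%_; _≡ᵇ_; _<ᵇ_)
open import Data.Bool using (Bool; true; false; if_then_else_)
open import Data.Integer as ℤ using (ℤ; +_)
open import Data.Integer.DivMod using (_%ℕ_)

-- a mod m, the residue in {0,…,m-1}, for an integer a and m ≥ 1.
-- (For m = 0 we return 0; this case never occurs below since n = 4k ≥ 4.)
zmod : ℤ → ℕ → ℕ
zmod a zero    = 0
zmod a (suc m) = a %ℕ suc m

π : (n i j : ℕ) → ℕ
π n i j = 1 + zmod ((+ (n + 1) ℤ.- + i) ℤ.- + j) (n ∸ 1)

isOdd : ℕ → Bool
isOdd i = (i % 2) ≡ᵇ 1

-- S(i,j) for odd i and i < j ≤ n, rules (1)–(3)
Sodd : (n i j : ℕ) → ℕ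
Sodd n i j =
  if i ≡ᵇ (n ∸ 1) then 3
  else if (2 * i) <ᵇ (n + 1) then                           -- (1): i ≤ n/2
    (if j ≡ᵇ n then π n i i else π n i j)
  else                                                      -- (2): n/2 < i ≤ n-3
    (if j ≡ᵇ (i + 1) then π n i i
     else if j ≡ᵇ n then π n i (i + 1)
     else π n i j)

-- S(i,j) for i < j ≤ n, adding rule (4) for even i
Supper : (n i j : ℕ) → ℕ
Supper n i j =
  if isOdd i then Sodd n i j
  else if isOdd j then Sodd n (i ∸ 1) (j + 1)
  else Sodd n (i ∸ 1) (j ∸ 1)

-- the symmetric table: S(j,i) := S(i,j); diagonal unused (set to 0)
S : (n i j : ℕ) → ℕ
S n i j =
  if i <ᵇ j then Supper n i j
  else if j <ᵇ i then Supper n j i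
  else 0

{-# OPTIONS --safe #-}
module Submission where

-- π_x(y) = 1 + ((n + 1 − x − y) mod (n − 1)) depends only on x + y modulo n − 1, so y ↦ π_x(y)
-- is injective on {1, …, n − 1}. Every row i is shown to have the form S(i, j) = π_x(key j) for a
-- single x and an injective key from the columns j ≠ i into {1, …, n − 1}; the row is then
-- injective, hence by pigeonhole a bijection onto the rounds.
--
-- For odd i ≤ n − 3, rules (1) and (2) read S(i, j) = π_i(τ j) for j > i, where τ is a product of
-- at most two transpositions sending i to n; for j < i, symmetry and rule (4) give π(i + j), and τ
-- fixes j. By rule (4) the even row i + 1 is the odd row i composed with the involution
-- 2b + 1 ↔ 2b + 2. In the last row n − 1 = 4c + 3 the keys are j on odd columns, n − 1 on column n,
-- and 2(1 + 2b) or 2(2 + 2d) on the even columns up to, or beyond, n/2. Odd and even keys cannot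
-- collide, and the two even families differ in the parity of their halves: this is where 4 ∣ n
-- is used.

open import Defs
open import Data.Bool using (true; false; T; if_then_else_)
open import Data.Bool.Properties using (if-float)
open import Data.Nat
open import Data.Nat.Properties
open import Data.Nat.DivMod using (m≡m%n+[m/n]*n; [m+n]%n≡m%n; m≤n⇒m%n≡m; m<n⇒m%n≡m; n%n≡0; %-remove-+ʳ)
open import Data.Nat.Divisibility using (_∣_; divides; n∣m*n; m∣m*n; ∣m⇒∣m*n; ∣m+n∣m⇒∣n; >⇒∤)
open import Data.Nat.Tactic.RingSolver using (solve)
open import Data.Integer as ℤ using (+_; -[1+_]; _⊖_)
import Data.Integer.Properties as ℤ
open import Data.Integer.DivMod using (_%ℕ_; n%ℕd<d)
open import Data.Fin as Fin using (Fin; toℕ; fromℕ<; punchOut)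
import Data.Fin.Properties as Fin
open import Data.List using (_∷_; [])
open import Data.Product using (Σ; ∃; ∃₂; _×_; _,_; proj₁; proj₂)
open import Data.Sum using (inj₁; inj₂)
open import Function using (_∘_)
open import Relation.Binary.PropositionalEquality
open import Relation.Binary.Definitions using (tri<; tri≈; tri>)
open import Relation.Nullary using (¬_; contradiction; yes; no)

T⇒≡true : ∀ {b} → T b → b ≡ true
T⇒≡true {true} _ = refl

¬T⇒≡false : ∀ {b} → ¬ T b → b ≡ false
¬T⇒≡false {false} _   = refl
¬T⇒≡false {true}  ¬tt = contradiction _ ¬tt

≡⇒≡ᵇ≡true : ∀ {m n} → m ≡ n → (m ≡ᵇ n) ≡ true
≡⇒≡ᵇ≡true {m} {n} m≡n = T⇒≡true (≡⇒≡ᵇ m n m≡n)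

≢⇒≡ᵇ≡false : ∀ {m n} → m ≢ n → (m ≡ᵇ n) ≡ false
≢⇒≡ᵇ≡false {m} {n} m≢n = ¬T⇒≡false (m≢n ∘ ≡ᵇ⇒≡ m n)

<⇒<ᵇ≡true : ∀ {m n} → m < n → (m <ᵇ n) ≡ true
<⇒<ᵇ≡true m<n = T⇒≡true (<⇒<ᵇ m<n)

≥⇒<ᵇ≡false : ∀ {m n} → n ≤ m → (m <ᵇ n) ≡ false
≥⇒<ᵇ≡false {m} {n} n≤m = ¬T⇒≡false (λ t → <⇒≱ (<ᵇ⇒< m n t) n≤m)

isOdd-+ : ∀ k {m} → 2 ∣ m → isOdd (k + m) ≡ isOdd k
isOdd-+ k 2∣m = cong (_≡ᵇ 1) (%-remove-+ʳ k 2∣m)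

isOdd[1+2*a] : ∀ a → isOdd (1 + 2 * a) ≡ true
isOdd[1+2*a] a = isOdd-+ 1 (m∣m*n a)

isOdd[2*a] : ∀ a → isOdd (2 * a) ≡ false
isOdd[2*a] a = isOdd-+ 0 (m∣m*n a)

isOdd[2+2*a] : ∀ a → isOdd (2 + 2 * a) ≡ false
isOdd[2+2*a] a = isOdd-+ 2 (m∣m*n a)

isOdd[3+4*c] : ∀ c → isOdd (3 + 4 * c) ≡ true
isOdd[3+4*c] c = isOdd-+ 3 (∣m⇒∣m*n c (divides 2 refl))

isOdd[4+4*c] : ∀ c → isOdd (4 + 4 * c) ≡ false
isOdd[4+4*c] c = isOdd-+ 4 (∣m⇒∣m*n c (divides 2 refl))

parity-≢ : ∀ {x y} → isOdd x ≡ true → isOdd y ≡ false → x ≢ y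
parity-≢ odd-x even-y refl with trans (sym odd-x) even-y
... | ()

1+2*a≢2*b : ∀ a b → 1 + 2 * a ≢ 2 * b
1+2*a≢2*b a b = parity-≢ (isOdd[1+2*a] a) (isOdd[2*a] b)

1+2*a≢2+2*b : ∀ a b → 1 + 2 * a ≢ 2 + 2 * b
1+2*a≢2+2*b a b = parity-≢ (isOdd[1+2*a] a) (isOdd[2+2*a] b)

data OddEven : ℕ → Set where
  odd  : ∀ a → OddEven (1 + 2 * a)
  even : ∀ a → OddEven (2 + 2 * a)

oddEven : ∀ j → OddEven (suc j)
oddEven zero = odd 0
oddEven (suc j) with oddEven j
... | odd a  = even a
... | even a = subst OddEven (cong suc (*-suc 2 a)) (odd (suc a))

swap : ℕ → ℕ
swap j = if isOdd j then j + 1 else j ∸ 1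

swap-of-odd : ∀ {i} → isOdd i ≡ true → swap i ≡ suc i
swap-of-odd {i} odd-i rewrite odd-i = +-comm i 1

swap-odd : ∀ b → swap (1 + 2 * b) ≡ 2 + 2 * b
swap-odd b = swap-of-odd (isOdd[1+2*a] b)

swap-even : ∀ b → swap (2 + 2 * b) ≡ 1 + 2 * b
swap-even b rewrite isOdd[2+2*a] b = refl

swap-involutive : ∀ j → swap (swap j) ≡ j
swap-involutive zero = refl
swap-involutive (suc j) with oddEven j
... | odd b  = trans (cong swap (swap-odd b)) (swap-even b)
... | even b = trans (cong swap (swap-even b)) (swap-odd b)

swap-injective : ∀ {j j′} → swap j ≡ swap j′ → j ≡ j′
swap-injective {j} {j′} e = trans (sym (swap-involutive j)) (trans (cong swap e) (swap-involutive j′))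

∸1≤swap : ∀ j → j ∸ 1 ≤ swap j
∸1≤swap j with isOdd j
... | true  = ≤-trans (m∸n≤m j 1) (m≤m+n j 1)
... | false = ≤-refl

transpose : ℕ → ℕ → ℕ → ℕ
transpose a b x = if x ≡ᵇ a then b else if x ≡ᵇ b then a else x

module _ {a b : ℕ} where

  transpose-left : transpose a b a ≡ b
  transpose-left rewrite ≡⇒≡ᵇ≡true (refl {x = a}) = refl

  transpose-fix : ∀ {x} → x ≢ a → x ≢ b → transpose a b x ≡ x
  transpose-fix x≢a x≢b rewrite ≢⇒≡ᵇ≡false x≢a | ≢⇒≡ᵇ≡false x≢b = refl

  transpose-right : transpose a b b ≡ a
  transpose-right with b ≟ a
  ... | yes refl = transpose-left
  ... | no b≢a rewrite ≢⇒≡ᵇ≡false b≢a | ≡⇒≡ᵇ≡true (refl {x = b}) = refl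

  transpose-involutive : ∀ x → transpose a b (transpose a b x) ≡ x
  transpose-involutive x with x ≟ a | x ≟ b
  ... | yes refl | _        = trans (cong (transpose a b) transpose-left) transpose-right
  ... | no _     | yes refl = trans (cong (transpose a b) transpose-right) transpose-left
  ... | no x≢a   | no x≢b   = trans (cong (transpose a b) (transpose-fix x≢a x≢b)) (transpose-fix x≢a x≢b)

  transpose-injective : ∀ {x y} → transpose a b x ≡ transpose a b y → x ≡ y
  transpose-injective {x} {y} e =
    trans (sym (transpose-involutive x)) (trans (cong (transpose a b) e) (transpose-involutive y))

  transpose-preserves : ∀ {p} (P : ℕ → Set p) {x} → P a → P b → P x → P (transpose a b x)
  transpose-preserves P {x} pa pb px with x ≡ᵇ a | x ≡ᵇ b
  ... | true  | _     = pb
  ... | false | true  = pa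
  ... | false | false = px

-- The permutation of the columns behind rules (1) and (2).
partner : ℕ → ℕ → ℕ → ℕ
partner n i j with 2 * i <? n + 1
... | yes _ = transpose i n j
... | no _  = transpose (suc i) n (transpose i (suc i) j)

module _ {n i : ℕ} where

  partner-self : partner n i i ≡ n
  partner-self with 2 * i <? n + 1
  ... | yes _ = transpose-left {i} {n}
  ... | no _  = trans (cong (transpose (suc i) n) (transpose-left {i} {suc i})) (transpose-left {suc i} {n})

  partner-injective : ∀ {j j′} → partner n i j ≡ partner n i j′ → j ≡ j′
  partner-injective e with 2 * i <? n + 1
  ... | yes _ = transpose-injective e
  ... | no _  = transpose-injective (transpose-injective e)

  partner-fix : ∀ {j} → j ≢ i → j ≢ suc i → j ≢ n → partner n i j ≡ j
  partner-fix j≢i j≢1+i j≢n with 2 * i <? n + 1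
  ... | yes _ = transpose-fix j≢i j≢n
  ... | no _  = trans (cong (transpose (suc i) n) (transpose-fix j≢i j≢1+i)) (transpose-fix j≢1+i j≢n)

  partner-preserves : ∀ {p} (P : ℕ → Set p) {j} → P i → P (suc i) → P n → P j → P (partner n i j)
  partner-preserves P pi p1+i pn pj with 2 * i <? n + 1
  ... | yes _ = transpose-preserves P pi pn pj
  ... | no _  = transpose-preserves P p1+i pn (transpose-preserves P pi p1+i pj)

  partner-last-rule₁ : 2 * i < n + 1 → partner n i n ≡ i
  partner-last-rule₁ rule₁ with 2 * i <? n + 1
  ... | yes _     = transpose-right {i} {n}
  ... | no ¬rule₁ = contradiction rule₁ ¬rule₁

  partner-last-rule₂ : n + 1 ≤ 2 * i → i ≢ n → suc i ≢ n → partner n i n ≡ suc i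
  partner-last-rule₂ rule₂ i≢n 1+i≢n with 2 * i <? n + 1
  ... | yes rule₁ = contradiction rule₂ (<⇒≱ rule₁)
  ... | no _      =
    trans (cong (transpose (suc i) n) (transpose-fix (i≢n ∘ sym) (1+i≢n ∘ sym))) (transpose-right {suc i} {n})

S-diagonal : ∀ n i → S n i i ≡ 0
S-diagonal n i rewrite ≥⇒<ᵇ≡false (≤-refl {i}) = refl

S-upper : ∀ n {i j} → i < j → S n i j ≡ Supper n i j
S-upper _ i<j rewrite <⇒<ᵇ≡true i<j = refl

S-lower : ∀ n {i j} → j < i → S n i j ≡ Supper n j i
S-lower _ j<i rewrite ≥⇒<ᵇ≡false (<⇒≤ j<i) | <⇒<ᵇ≡true j<i = refl

Supper-odd : ∀ n i j → isOdd i ≡ true → Supper n i j ≡ Sodd n i j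
Supper-odd _ _ _ odd-i rewrite odd-i = refl

Supper-even : ∀ n i j → isOdd i ≡ false → Supper n i j ≡ Sodd n (i ∸ 1) (swap j)
Supper-even n i j even-i rewrite even-i = sym (if-float (Sodd n (i ∸ 1)) (isOdd j))

Sodd-last-row : ∀ n j → Sodd n (n ∸ 1) j ≡ 3
Sodd-last-row n j rewrite ≡⇒≡ᵇ≡true (refl {x = n ∸ 1}) = refl

Sodd≡π∘partner : ∀ {n i j} → suc i < n → j ≢ i → Sodd n i j ≡ π n i (partner n i j)
Sodd≡π∘partner {n} {i} {j} 1+i<n j≢i
  rewrite ≢⇒≡ᵇ≡false (<⇒≢ (<⇒≤pred 1+i<n)) with 2 * i <? n + 1
... | yes rule₁ rewrite <⇒<ᵇ≡true rule₁ | ≢⇒≡ᵇ≡false j≢i = sym (if-float (π n i) (j ≡ᵇ n))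
... | no ¬rule₁ rewrite ≥⇒<ᵇ≡false (≮⇒≥ ¬rule₁) | ≢⇒≡ᵇ≡false j≢i | +-comm i 1
  with j ≡ᵇ suc i in eq
...   | true  = cong (π n i) (sym (transpose-fix (λ ()) (<⇒≢ (<-trans (n<1+n i) 1+i<n))))
...   | false rewrite eq = sym (if-float (π n i) (j ≡ᵇ n))

-- The round function π

[m+n]%o≡m%o⇒o∣n : ∀ m n o .{{_ : NonZero o}} → (m + n) % o ≡ m % o → o ∣ n
[m+n]%o≡m%o⇒o∣n m n o eq = ∣m+n∣m⇒∣n (divides ((m + n) / o) (+-cancelˡ-≡ (m % o) _ _ (begin
  m % o + (m / o * o + n)        ≡⟨ +-assoc (m % o) _ n ⟨
  m % o + m / o * o + n          ≡⟨ cong (_+ n) (m≡m%n+[m/n]*n m o) ⟨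
  m + n                          ≡⟨ m≡m%n+[m/n]*n (m + n) o ⟩
  (m + n) % o + (m + n) / o * o  ≡⟨ cong (_+ (m + n) / o * o) eq ⟩
  m % o + (m + n) / o * o        ∎))) (n∣m*n (m / o))
  where open ≡-Reasoning

m∸n≡m∸[n+o]+o : ∀ {m} n o → n + o ≤ m → m ∸ n ≡ m ∸ (n + o) + o
m∸n≡m∸[n+o]+o {m} n o n+o≤m = begin
  m ∸ n                ≡⟨ cong (_∸ n) (m∸n+n≡m n+o≤m) ⟨
  r + (n + o) ∸ n      ≡⟨ cong (λ k → r + k ∸ n) (+-comm n o) ⟩
  r + (o + n) ∸ n      ≡⟨ cong (_∸ n) (+-assoc r o n) ⟨
  r + o + n ∸ n        ≡⟨ m+n∸n≡m (r + o) n ⟩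
  r + o                ∎
  where
  open ≡-Reasoning
  r = m ∸ (n + o)

-[1+m]%ℕ[1+n] : ∀ t M → t ≤ M → -[1+ t ] %ℕ suc M ≡ (M ∸ t) % suc M
-[1+m]%ℕ[1+n] t M t≤M with m≤n⇒m<n∨m≡n t≤M
... | inj₁ t<M with suc t % suc M | m<n⇒m%n≡m (s≤s t<M)
...   | _ | refl = sym (m≤n⇒m%n≡m (m∸n≤m M t))
-[1+m]%ℕ[1+n] t M t≤M | inj₂ refl with suc t % suc t | n%n≡0 (suc t)
...   | _ | refl = cong (_% suc t) (sym (n∸n≡0 t))

[m⊖n]%ℕo : ∀ a s M .{{_ : NonZero M}} → s ≤ a + M → (a ⊖ s) %ℕ M ≡ (a + M ∸ s) % M
[m⊖n]%ℕo a       zero    M       _  = sym ([m+n]%n≡m%n a M)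
[m⊖n]%ℕo zero    (suc t) (suc M) le = -[1+m]%ℕ[1+n] t M (s≤s⁻¹ le)
[m⊖n]%ℕo (suc a) (suc s) M       le =
  trans (cong (_%ℕ M) (ℤ.[1+m]⊖[1+n]≡m⊖n a s)) ([m⊖n]%ℕo a s M (s≤s⁻¹ le))

π-as-⊖ : ∀ n x y → π n x y ≡ 1 + zmod ((n + 1) ⊖ (x + y)) (n ∸ 1)
π-as-⊖ n x y = cong (λ z → 1 + zmod z (n ∸ 1)) (begin
  + a ℤ.- + x ℤ.- + y          ≡⟨ ℤ.+-assoc (+ a) (ℤ.- + x) (ℤ.- + y) ⟩
  + a ℤ.+ (ℤ.- + x ℤ.- + y)    ≡⟨ cong (λ z → + a ℤ.+ z) (ℤ.neg-distrib-+ (+ x) (+ y)) ⟨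
  + a ℤ.- (+ x ℤ.+ + y)        ≡⟨ cong (λ z → + a ℤ.- z) (ℤ.pos-+ x y) ⟨
  + a ℤ.- + (x + y)            ≡⟨ ℤ.m-n≡m⊖n a (x + y) ⟩
  a ⊖ (x + y)                  ∎)
  where
  open ≡-Reasoning
  a = n + 1

π-cong : ∀ {n x y x′ y′} → x + y ≡ x′ + y′ → π n x y ≡ π n x′ y′
π-cong {n} {x} {y} {x′} {y′} e =
  trans (π-as-⊖ n x y) (trans (cong (λ s → 1 + zmod ((n + 1) ⊖ s) (n ∸ 1)) e) (sym (π-as-⊖ n x′ y′)))

π-comm : ∀ {n} x y → π n x y ≡ π n y x
π-comm {n} x y = π-cong {n} {x} {y} {y} {x} (+-comm x y)

-- (n + 1) + (n − 1) = 2n: the residue defining π, shifted by one period to stay in ℕ.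
π-as-residue : ∀ {m} x y → x + y ≤ (2 + m) + (2 + m) →
               π (2 + m) x y ≡ suc (((2 + m) + (2 + m) ∸ (x + y)) % (1 + m))
π-as-residue {m} x y x+y≤2n = begin
  π (2 + m) x y                                    ≡⟨ π-as-⊖ (2 + m) x y ⟩
  suc ((2 + m + 1 ⊖ (x + y)) %ℕ (1 + m))            ≡⟨ cong suc ([m⊖n]%ℕo (2 + m + 1) (x + y) (1 + m) x+y≤K) ⟩
  suc ((2 + m + 1 + (1 + m) ∸ (x + y)) % (1 + m))  ≡⟨ cong (λ k → suc ((k ∸ (x + y)) % (1 + m))) 2n≡K ⟨
  suc (((2 + m) + (2 + m) ∸ (x + y)) % (1 + m))    ∎
  where
  open ≡-Reasoning
  2n≡K : (2 + m) + (2 + m) ≡ 2 + m + 1 + (1 + m)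
  2n≡K = solve (m ∷ [])
  x+y≤K = ≤-trans x+y≤2n (≤-reflexive 2n≡K)

π-bounds : ∀ {m} x y → 1 ≤ π (2 + m) x y × π (2 + m) x y ≤ 1 + m
π-bounds {m} x y = s≤s z≤n , n%ℕd<d (+ (2 + m + 1) ℤ.- + x ℤ.- + y) (1 + m)

n∣m∧m<n⇒m≡0 : ∀ {d o} → o ∣ d → d < o → d ≡ 0
n∣m∧m<n⇒m≡0 {zero}  _   _   = refl
n∣m∧m<n⇒m≡0 {suc _} o∣d d<o = contradiction o∣d (>⇒∤ d<o)

π-injective-+ : ∀ {m x y d} → x ≤ 2 + m → 1 ≤ y → y + d ≤ 1 + m →
                π (2 + m) x y ≡ π (2 + m) x (y + d) → d ≡ 0
π-injective-+ {m} {x} {y} {d} x≤n 1≤y y+d≤M eq = n∣m∧m<n⇒m≡0 M∣d d<M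
  where
  M = 1 + m
  2n = (2 + m) + (2 + m)
  s+d≤2n : x + (y + d) ≤ 2n
  s+d≤2n = +-mono-≤ x≤n (m≤n⇒m≤1+n y+d≤M)
  s≤2n : x + y ≤ 2n
  s≤2n = ≤-trans (+-monoʳ-≤ x (m≤m+n y d)) s+d≤2n
  residues : (2n ∸ (x + (y + d)) + d) % M ≡ (2n ∸ (x + (y + d))) % M
  residues = begin
    (2n ∸ (x + (y + d)) + d) % M  ≡⟨ cong (λ k → (2n ∸ k + d) % M) (+-assoc x y d) ⟨
    (2n ∸ (x + y + d) + d) % M    ≡⟨ cong (_% M) (m∸n≡m∸[n+o]+o (x + y) d (≤-trans (≤-reflexive (+-assoc x y d)) s+d≤2n)) ⟨
    (2n ∸ (x + y)) % M
      ≡⟨ suc-injective (trans (sym (π-as-residue x y s≤2n)) (trans eq (π-as-residue x (y + d) s+d≤2n))) ⟩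
    (2n ∸ (x + (y + d))) % M      ∎
    where open ≡-Reasoning
  M∣d : M ∣ d
  M∣d = [m+n]%o≡m%o⇒o∣n (2n ∸ (x + (y + d))) d M residues
  d<M : d < M
  d<M = ≤-trans (+-monoˡ-≤ d 1≤y) y+d≤M

π-injective : ∀ {m x y y′} → x ≤ 2 + m → 1 ≤ y → y ≤ 1 + m → 1 ≤ y′ → y′ ≤ 1 + m →
              π (2 + m) x y ≡ π (2 + m) x y′ → y ≡ y′
π-injective {y = y} {y′} x≤n 1≤y y≤M 1≤y′ y′≤M eq with ≤-total y y′
... | inj₁ y≤y′ with d , refl ← m≤n⇒∃[o]m+o≡n y≤y′ =
  sym (trans (cong (λ k → y + k) (π-injective-+ x≤n 1≤y y′≤M eq)) (+-identityʳ y))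
... | inj₂ y′≤y with d , refl ← m≤n⇒∃[o]m+o≡n y′≤y =
  trans (cong (λ k → y′ + k) (π-injective-+ x≤n 1≤y′ y≤M (sym eq))) (+-identityʳ y′)

π-shift : ∀ {m x y x′ y′} → x + y + (1 + m) ≡ x′ + y′ → x + y + (1 + m) ≤ (2 + m) + (2 + m) →
          π (2 + m) x′ y′ ≡ π (2 + m) x y
π-shift {m} {x} {y} {x′} {y′} e s+M≤2n = begin
  π (2 + m) x′ y′                   ≡⟨ π-cong {2 + m} {x′} {y′} {x + y} {M} (sym e) ⟩
  π (2 + m) (x + y) M               ≡⟨ π-as-residue (x + y) M s+M≤2n ⟩
  suc ((2n ∸ (x + y + M)) % M)      ≡⟨ cong suc ([m+n]%n≡m%n (2n ∸ (x + y + M)) M) ⟨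
  suc ((2n ∸ (x + y + M) + M) % M)  ≡⟨ cong (λ k → suc (k % M)) (m∸n≡m∸[n+o]+o (x + y) M s+M≤2n) ⟨
  suc ((2n ∸ (x + y)) % M)          ≡⟨ π-as-residue x y (≤-trans (m≤m+n (x + y) M) s+M≤2n) ⟨
  π (2 + m) x y                     ∎
  where
  open ≡-Reasoning
  M = 1 + m
  2n = (2 + m) + (2 + m)

π-last-diagonal : ∀ m → π (4 + m) (3 + m) (3 + m) ≡ 3
π-last-diagonal m = begin
  π (4 + m) (3 + m) (3 + m)         ≡⟨ π-as-residue {2 + m} (3 + m) (3 + m) s≤2n ⟩
  suc ((2n ∸ s) % (3 + m))          ≡⟨ cong (λ k → suc ((k ∸ s) % (3 + m))) 2n≡2+s ⟩
  suc ((2 + s ∸ s) % (3 + m))       ≡⟨ cong (λ k → suc (k % (3 + m))) (m+n∸n≡m 2 s) ⟩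
  3                                 ∎
  where
  open ≡-Reasoning
  2n = (4 + m) + (4 + m)
  s  = (3 + m) + (3 + m)
  2n≡2+s : (4 + m) + (4 + m) ≡ 2 + ((3 + m) + (3 + m))
  2n≡2+s = solve (m ∷ [])
  s≤2n = ≤-trans (m≤n+m s 2) (≤-reflexive (sym 2n≡2+s))

missing-point⇒collision : ∀ {m} (f : Fin (suc m) → Fin (suc m)) r → (∀ t → r ≢ f t) →
                          ∃₂ λ s t → s Fin.< t × f s ≡ f t
missing-point⇒collision f r missed
  with s , t , s<t , e ← Fin.pigeonhole (n<1+n _) (λ t → punchOut (missed t)) =
  s , t , s<t , Fin.punchOut-injective (missed s) (missed t) e

injective⇒surjective : ∀ {m} (f : Fin m → Fin m) → (∀ {s t} → f s ≡ f t → s ≡ t) →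
                       ∀ r → ∃ λ t → f t ≡ r
injective⇒surjective {suc m} f f-inj r with Fin.any? (λ t → f t Fin.≟ r)
... | yes hit = hit
... | no ¬hit with s , t , s<t , e ← missing-point⇒collision f r (λ t r≡ft → ¬hit (t , sym r≡ft)) =
  contradiction (cong toℕ (f-inj e)) (<⇒≢ s<t)

bounded-injection-surjective : ∀ m (f : ℕ → ℕ) → (∀ {x} → x < m → f x < m) →
                               (∀ {x y} → x < m → y < m → f x ≡ f y → x ≡ y) →
                               ∀ {r} → r < m → ∃ λ x → x < m × f x ≡ r
bounded-injection-surjective m f f<m f-inj {r} r<m = toℕ t , Fin.toℕ<n t , (begin
  f (toℕ t)                ≡⟨ Fin.toℕ-fromℕ< _ ⟨
  toℕ (F t)                ≡⟨ cong toℕ Ft≡r ⟩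
  toℕ (fromℕ< r<m)         ≡⟨ Fin.toℕ-fromℕ< r<m ⟩
  r                        ∎)
  where
  open ≡-Reasoning
  F : Fin m → Fin m
  F t = fromℕ< (f<m (Fin.toℕ<n t))
  F-injective : ∀ {s t} → F s ≡ F t → s ≡ t
  F-injective {s} {t} e = Fin.toℕ-injective (f-inj (Fin.toℕ<n s) (Fin.toℕ<n t)
    (trans (sym (Fin.toℕ-fromℕ< _)) (trans (cong toℕ e) (Fin.toℕ-fromℕ< _))))
  hit = injective⇒surjective F F-injective (fromℕ< r<m)
  t = proj₁ hit
  Ft≡r = proj₂ hit

Column : ℕ → ℕ → ℕ → Set
Column n i j = 1 ≤ j × j ≤ n × j ≢ i

record RowKeys (n i : ℕ) : Set where
  field
    pivot         : ℕ
    pivot≤n       : pivot ≤ n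
    key           : ∀ {j} → Column n i j → ℕ
    key-bounds    : ∀ {j} (c : Column n i j) → 1 ≤ key c × key c ≤ n ∸ 1
    key-injective : ∀ {j j′} (c : Column n i j) (c′ : Column n i j′) → key c ≡ key c′ → j ≡ j′
    S≡π∘key       : ∀ {j} (c : Column n i j) → S n i j ≡ π n pivot (key c)

PlaysEachRoundOnce : ℕ → ℕ → Set
PlaysEachRoundOnce n i =
  ((j : ℕ) → 1 ≤ j → j ≤ n → j ≢ i → 1 ≤ S n i j × S n i j ≤ n ∸ 1)
  × ((r : ℕ) → 1 ≤ r → r ≤ n ∸ 1 →
      Σ ℕ (λ j → (1 ≤ j × j ≤ n × j ≢ i × S n i j ≡ r)
        × ((j′ : ℕ) → 1 ≤ j′ → j′ ≤ n → j′ ≢ i → S n i j′ ≡ r → j′ ≡ j)))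

module _ {m i} (keys : RowKeys (2 + m) i) where

  open RowKeys keys

  S-bounds : ∀ {j} → Column (2 + m) i j → 1 ≤ S (2 + m) i j × S (2 + m) i j ≤ 1 + m
  S-bounds c = subst (λ k → 1 ≤ k × k ≤ 1 + m) (sym (S≡π∘key c)) (π-bounds pivot (key c))

  S-injective : ∀ {j j′} → Column (2 + m) i j → Column (2 + m) i j′ →
                S (2 + m) i j ≡ S (2 + m) i j′ → j ≡ j′
  S-injective c c′ e = key-injective c c′ (π-injective pivot≤n
    (proj₁ (key-bounds c)) (proj₂ (key-bounds c)) (proj₁ (key-bounds c′)) (proj₂ (key-bounds c′))
    (trans (sym (S≡π∘key c)) (trans e (S≡π∘key c′))))

  private
    S-diagonal′ : ∀ {x} → suc x ≡ i → S (2 + m) i (suc x) ≡ 0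
    S-diagonal′ 1+x≡i = trans (cong (S (2 + m) i) 1+x≡i) (S-diagonal (2 + m) i)

    S-off-diagonal : ∀ {x} → x < 2 + m → suc x ≢ i → S (2 + m) i (suc x) ≢ 0
    S-off-diagonal x<n 1+x≢i = >⇒≢ (proj₁ (S-bounds (s≤s z≤n , x<n , 1+x≢i)))

    -- With the diagonal, where S is 0, the row becomes an injective endomap of {0, …, n − 1}.
    row : ℕ → ℕ
    row x = S (2 + m) i (suc x)

    row<n : ∀ {x} → x < 2 + m → row x < 2 + m
    row<n {x} x<n with suc x ≟ i
    ... | yes 1+x≡i = subst (_< 2 + m) (sym (S-diagonal′ 1+x≡i)) (s≤s z≤n)
    ... | no 1+x≢i  = s≤s (proj₂ (S-bounds (s≤s z≤n , x<n , 1+x≢i)))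

    row-injective : ∀ {x y} → x < 2 + m → y < 2 + m → row x ≡ row y → x ≡ y
    row-injective {x} {y} x<n y<n e with suc x ≟ i | suc y ≟ i
    ... | yes 1+x≡i | yes 1+y≡i = suc-injective (trans 1+x≡i (sym 1+y≡i))
    ... | yes 1+x≡i | no 1+y≢i  = contradiction (trans (sym e) (S-diagonal′ 1+x≡i)) (S-off-diagonal y<n 1+y≢i)
    ... | no 1+x≢i  | yes 1+y≡i = contradiction (trans e (S-diagonal′ 1+y≡i)) (S-off-diagonal x<n 1+x≢i)
    ... | no 1+x≢i  | no 1+y≢i  =
      suc-injective (S-injective (s≤s z≤n , x<n , 1+x≢i) (s≤s z≤n , y<n , 1+y≢i) e)

  plays-each-round-once : PlaysEachRoundOnce (2 + m) i
  plays-each-round-once = (λ j 1≤j j≤n j≢i → S-bounds (1≤j , j≤n , j≢i)) , unique-opponent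
    where
    unique-opponent : (r : ℕ) → 1 ≤ r → r ≤ 1 + m →
      Σ ℕ (λ j → (1 ≤ j × j ≤ 2 + m × j ≢ i × S (2 + m) i j ≡ r)
        × ((j′ : ℕ) → 1 ≤ j′ → j′ ≤ 2 + m → j′ ≢ i → S (2 + m) i j′ ≡ r → j′ ≡ j))
    unique-opponent r 1≤r r≤n-1 =
      suc x , (s≤s z≤n , x<n , 1+x≢i , row-x≡r) ,
      λ j′ 1≤j′ j′≤n j′≢i e →
        S-injective (1≤j′ , j′≤n , j′≢i) (s≤s z≤n , x<n , 1+x≢i) (trans e (sym row-x≡r))
      where
      hit = bounded-injection-surjective (2 + m) row row<n row-injective (s≤s r≤n-1)
      x = proj₁ hit
      x<n = proj₁ (proj₂ hit)
      row-x≡r = proj₂ (proj₂ hit)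
      1+x≢i : suc x ≢ i
      1+x≢i 1+x≡i = contradiction (trans (sym row-x≡r) (S-diagonal′ 1+x≡i)) (>⇒≢ 1≤r)

-- Odd and even rows

S-below-odd : ∀ {n i b} → isOdd i ≡ true → 1 + 2 * b < i → i < n →
              S n i (1 + 2 * b) ≡ π n i (1 + 2 * b)
S-below-odd {n} {i} {b} odd-i j<i i<n = begin
  S n i j                ≡⟨ S-lower n j<i ⟩
  Supper n j i           ≡⟨ Supper-odd n j i (isOdd[1+2*a] b) ⟩
  Sodd n j i             ≡⟨ Sodd≡π∘partner {n} {j} {i} (≤-<-trans j<i i<n) i≢j ⟩
  π n j (partner n j i)  ≡⟨ cong (π n j) (partner-fix i≢j (parity-≢ odd-i (isOdd[2+2*a] b)) (<⇒≢ i<n)) ⟩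
  π n j i                ≡⟨ π-comm {n} j i ⟩
  π n i j                ∎
  where
  open ≡-Reasoning
  j = 1 + 2 * b
  i≢j = ≢-sym (<⇒≢ j<i)

S-below-even : ∀ {n i b} → isOdd i ≡ true → 2 + 2 * b < i → suc i < n →
               S n i (2 + 2 * b) ≡ π n i (2 + 2 * b)
S-below-even {n} {i} {b} odd-i j<i 1+i<n = begin
  S n i j                      ≡⟨ S-lower n j<i ⟩
  Supper n j i                 ≡⟨ Supper-even n j i (isOdd[2+2*a] b) ⟩
  Sodd n x (swap i)            ≡⟨ cong (Sodd n x) (swap-of-odd odd-i) ⟩
  Sodd n x (suc i)             ≡⟨ Sodd≡π∘partner {n} {x} {suc i} (≤-<-trans x<i (<-trans (n<1+n i) 1+i<n)) 1+i≢x ⟩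
  π n x (partner n x (suc i))  ≡⟨ cong (π n x) (partner-fix 1+i≢x (i≢x ∘ suc-injective) (<⇒≢ 1+i<n)) ⟩
  π n x (suc i)                ≡⟨ π-cong {n} {x} {suc i} {i} {j} x+[1+i]≡i+j ⟩
  π n i j                      ∎
  where
  open ≡-Reasoning
  x = 1 + 2 * b
  j = 2 + 2 * b
  x<i : x < i
  x<i = <-trans (n<1+n x) j<i
  i≢x : i ≢ x
  i≢x = ≢-sym (<⇒≢ x<i)
  1+i≢x : suc i ≢ x
  1+i≢x = ≢-sym (<⇒≢ (<-trans x<i (n<1+n i)))
  x+[1+i]≡i+j : 1 + 2 * b + suc i ≡ i + (2 + 2 * b)
  x+[1+i]≡i+j = solve (b ∷ i ∷ [])

odd-row-keys : ∀ {n a} → 2 + 2 * a < n → RowKeys n (1 + 2 * a)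
odd-row-keys {n} {a} 1+i<n = record
  { pivot         = i
  ; pivot≤n       = i≤n
  ; key           = λ {j} _ → partner n i j
  ; key-bounds    = bounds
  ; key-injective = λ _ _ → partner-injective {n} {i}
  ; S≡π∘key       = S≡π∘partner
  }
  where
  i = 1 + 2 * a
  i<n = <-trans (n<1+n i) 1+i<n
  i≤n = <⇒≤ i<n
  bounds : ∀ {j} → Column n i j → 1 ≤ partner n i j × partner n i j ≤ n ∸ 1
  bounds {j} (1≤j , j≤n , j≢i) = 1≤p , <⇒≤pred (≤∧≢⇒< p≤n p≢n)
    where
    p≢n : partner n i j ≢ n
    p≢n p≡n = j≢i (partner-injective {n} {i} (trans p≡n (sym (partner-self {n} {i}))))
    in-range = partner-preserves (λ y → 1 ≤ y × y ≤ n) (s≤s z≤n , i≤n) (s≤s z≤n , <⇒≤ 1+i<n)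
                 (≤-trans (s≤s z≤n) i≤n , ≤-refl) (1≤j , j≤n)
    1≤p = proj₁ in-range
    p≤n = proj₂ in-range
  S≡π∘partner : ∀ {j} → Column n i j → S n i j ≡ π n i (partner n i j)
  S≡π∘partner {j} (1≤j , j≤n , j≢i) with <-cmp j i
  ... | tri≈ _ j≡i _ = contradiction j≡i j≢i
  ... | tri> _ _ i<j = begin
    S n i j               ≡⟨ S-upper n i<j ⟩
    Supper n i j          ≡⟨ Supper-odd n i j (isOdd[1+2*a] a) ⟩
    Sodd n i j            ≡⟨ Sodd≡π∘partner 1+i<n j≢i ⟩
    π n i (partner n i j) ∎
    where open ≡-Reasoning
  ... | tri< j<i _ _ = trans (S-below 1≤j j<i) (cong (π n i) (sym (partner-fix j≢i j≢1+i j≢n)))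
    where
    j≢1+i = <⇒≢ (<-trans j<i (n<1+n i))
    j≢n = <⇒≢ (<-trans j<i i<n)
    S-below : ∀ {j} → 1 ≤ j → j < i → S n i j ≡ π n i j
    S-below {suc j₀} _ j<i with oddEven j₀
    ... | odd b  = S-below-odd {n} {b = b} (isOdd[1+2*a] a) j<i i<n
    ... | even b = S-below-even {n} {b = b} (isOdd[1+2*a] a) j<i 1+i<n

module _ (n a : ℕ) where

  private
    i  = 2 + 2 * a
    i′ = 1 + 2 * a

  S-even-row-above : ∀ {j} → i < j → S n i j ≡ S n i′ (swap j)
  S-even-row-above {j} i<j = begin
    S n i j               ≡⟨ S-upper n i<j ⟩
    Supper n i j          ≡⟨ Supper-even n i j (isOdd[2+2*a] a) ⟩
    Sodd n i′ (swap j)    ≡⟨ Supper-odd n i′ (swap j) (isOdd[1+2*a] a) ⟨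
    Supper n i′ (swap j)  ≡⟨ S-upper n (≤-trans (<⇒≤pred i<j) (∸1≤swap j)) ⟨
    S n i′ (swap j)       ∎
    where open ≡-Reasoning

  S-even-row-below : ∀ {j} → 1 ≤ j → j < i → S n i j ≡ S n i′ (swap j)
  S-even-row-below {suc j₀} _ j<i with oddEven j₀
  ... | odd b with b ≟ a
  ...   | yes refl = begin
    S n i i′          ≡⟨ S-lower n j<i ⟩
    Supper n i′ i     ≡⟨ S-upper n (n<1+n i′) ⟨
    S n i′ i          ≡⟨ cong (S n i′) (swap-odd a) ⟨
    S n i′ (swap i′)  ∎
    where open ≡-Reasoning
  ...   | no b≢a = begin
    S n i x                  ≡⟨ S-lower n j<i ⟩
    Supper n x i             ≡⟨ Supper-odd n x i (isOdd[1+2*a] b) ⟩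
    Sodd n x i               ≡⟨ cong (Sodd n x) (swap-odd a) ⟨
    Sodd n x (swap i′)       ≡⟨ Supper-even n (2 + 2 * b) i′ (isOdd[2+2*a] b) ⟨
    Supper n (2 + 2 * b) i′  ≡⟨ S-lower n 2+2b<i′ ⟨
    S n i′ (2 + 2 * b)       ≡⟨ cong (S n i′) (swap-odd b) ⟨
    S n i′ (swap x)          ∎
    where
    open ≡-Reasoning
    x = 1 + 2 * b
    x<i′ : x < i′
    x<i′ = ≤∧≢⇒< (s≤s⁻¹ j<i) (b≢a ∘ *-cancelˡ-≡ b a 2 ∘ suc-injective)
    2+2b<i′ : 2 + 2 * b < i′
    2+2b<i′ = ≤∧≢⇒< x<i′ (≢-sym (1+2*a≢2+2*b a b))
  S-even-row-below {suc j₀} _ j<i | even b = begin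
    S n i y            ≡⟨ S-lower n j<i ⟩
    Supper n y i       ≡⟨ Supper-even n y i (isOdd[2+2*a] b) ⟩
    Sodd n x (swap i)  ≡⟨ cong (Sodd n x) (swap-even a) ⟩
    Sodd n x i′        ≡⟨ Supper-odd n x i′ (isOdd[1+2*a] b) ⟨
    Supper n x i′      ≡⟨ S-lower n (s≤s⁻¹ j<i) ⟨
    S n i′ x           ≡⟨ cong (S n i′) (swap-even b) ⟨
    S n i′ (swap y)    ∎
    where
    open ≡-Reasoning
    x = 1 + 2 * b
    y = 2 + 2 * b

  S-even-row : ∀ {j} → 1 ≤ j → j ≢ i → S n i j ≡ S n i′ (swap j)
  S-even-row {j} 1≤j j≢i with <-cmp j i
  ... | tri< j<i _ _ = S-even-row-below 1≤j j<i
  ... | tri≈ _ j≡i _ = contradiction j≡i j≢i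
  ... | tri> _ _ i<j = S-even-row-above i<j

swap-column : ∀ {n a j} → isOdd n ≡ false → Column n (2 + 2 * a) j → Column n (1 + 2 * a) (swap j)
swap-column {n} {a} {suc j₀} even-n (_ , j≤n , j≢i) with oddEven j₀
... | odd b rewrite swap-odd b =
  s≤s z≤n , ≤∧≢⇒< j≤n (parity-≢ (isOdd[1+2*a] b) even-n) , parity-≢ (isOdd[1+2*a] a) (isOdd[2+2*a] b) ∘ sym
... | even b rewrite swap-even b = s≤s z≤n , ≤-trans (n≤1+n _) j≤n , j≢i ∘ cong suc

even-row-keys : ∀ {n a} → isOdd n ≡ false → RowKeys n (1 + 2 * a) →
                       RowKeys n (2 + 2 * a)
even-row-keys {n} {a} even-n keys = record
  { pivot         = pivot
  ; pivot≤n       = pivot≤n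
  ; key           = λ c → key (swapped c)
  ; key-bounds    = λ c → key-bounds (swapped c)
  ; key-injective = λ c c′ e → swap-injective (key-injective (swapped c) (swapped c′) e)
  ; S≡π∘key       = λ c@(1≤j , _ , j≢i) → trans (S-even-row n a 1≤j j≢i) (S≡π∘key (swapped c))
  }
  where
  open RowKeys keys
  swapped : ∀ {j} → Column n (2 + 2 * a) j → Column n (1 + 2 * a) (swap j)
  swapped = swap-column {n} {a} even-n

-- The last row

m+o≡n⇒m≤n : ∀ {m n} o → m + o ≡ n → m ≤ n
m+o≡n⇒m≤n {m} o refl = m≤m+n m o

-- By rule (4), column 2 + 2b of the last row holds S(1 + 2b, n), which falls under rule (1) iff b ≤ c.
data LastRowColumn (c : ℕ) : ℕ → Set where
  last-column  : LastRowColumn c (4 + 4 * c)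
  odd-column   : ∀ b → 1 + 2 * b < 3 + 4 * c → LastRowColumn c (1 + 2 * b)
  rule₁-column : ∀ b → b ≤ c → LastRowColumn c (2 + 2 * b)
  rule₂-column : ∀ d → d < c → LastRowColumn c (2 + 2 * (suc c + d))

last-row-key : ∀ {c j} → LastRowColumn c j → ℕ
last-row-key {c} last-column   = 3 + 4 * c
last-row-key (odd-column b _)   = 1 + 2 * b
last-row-key (rule₁-column b _) = 2 * (1 + 2 * b)
last-row-key (rule₂-column d _) = 2 * (2 + 2 * d)

last-row-column : ∀ c {j} → Column (4 + 4 * c) (3 + 4 * c) j → LastRowColumn c j
last-row-column c {j} (1≤j , j≤n , j≢i) with j ≟ 4 + 4 * c
... | yes refl = last-column
... | no j≢n   = classify 1≤j (≤∧≢⇒< (<⇒≤pred (≤∧≢⇒< j≤n j≢n)) j≢i)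
  where
  classify : ∀ {j} → 1 ≤ j → j < 3 + 4 * c → LastRowColumn c j
  classify {suc j₀} _ j<i with oddEven j₀
  ... | odd b  = odd-column b j<i
  ... | even b with b ≤? c
  ...   | yes b≤c = rule₁-column b b≤c
  ...   | no b≰c with d , refl ← m≤n⇒∃[o]m+o≡n (≰⇒> b≰c) = rule₂-column d d<c
    where
    d<c : d < c
    d<c = ≰⇒> λ c≤d → <⇒≱ j<i (too-large c≤d)
      where
      too-large : c ≤ d → 3 + 4 * c ≤ 2 + 2 * (suc c + d)
      too-large c≤d with e , refl ← m≤n⇒∃[o]m+o≡n c≤d = m+o≡n⇒m≤n (1 + 2 * e) (solve (c ∷ e ∷ []))

last-row-key-bounds : ∀ {c j} (v : LastRowColumn c j) → 1 ≤ last-row-key v × last-row-key v ≤ 3 + 4 * c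
last-row-key-bounds last-column          = s≤s z≤n , ≤-refl
last-row-key-bounds (odd-column b j<i)   = s≤s z≤n , <⇒≤ j<i
last-row-key-bounds {c} (rule₁-column b b≤c) with e , refl ← m≤n⇒∃[o]m+o≡n b≤c =
  s≤s z≤n , m+o≡n⇒m≤n (1 + 4 * e) (solve (b ∷ e ∷ []))
last-row-key-bounds {c} (rule₂-column d d<c) with e , refl ← m≤n⇒∃[o]m+o≡n d<c =
  s≤s z≤n , m+o≡n⇒m≤n (3 + 4 * e) (solve (d ∷ e ∷ []))

last-row-key-injective : ∀ {c j j′} (v : LastRowColumn c j) (v′ : LastRowColumn c j′) →
                         last-row-key v ≡ last-row-key v′ → j ≡ j′
last-row-key-injective last-column last-column _ = refl
last-row-key-injective last-column (odd-column b j<i) e = contradiction (sym e) (<⇒≢ j<i)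
last-row-key-injective {c} last-column (rule₁-column b _) e =
  contradiction e (parity-≢ (isOdd[3+4*c] c) (isOdd[2*a] (1 + 2 * b)))
last-row-key-injective {c} last-column (rule₂-column d _) e =
  contradiction e (parity-≢ (isOdd[3+4*c] c) (isOdd[2*a] (2 + 2 * d)))
last-row-key-injective (odd-column b j<i) last-column e = contradiction e (<⇒≢ j<i)
last-row-key-injective (odd-column b _) (odd-column b′ _) e = e
last-row-key-injective (odd-column b _) (rule₁-column b′ _) e = contradiction e (1+2*a≢2*b b (1 + 2 * b′))
last-row-key-injective (odd-column b _) (rule₂-column d′ _) e = contradiction e (1+2*a≢2*b b (2 + 2 * d′))
last-row-key-injective {c} (rule₁-column b _) last-column e =
  contradiction (sym e) (parity-≢ (isOdd[3+4*c] c) (isOdd[2*a] (1 + 2 * b)))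
last-row-key-injective (rule₁-column b _) (odd-column b′ _) e = contradiction (sym e) (1+2*a≢2*b b′ (1 + 2 * b))
last-row-key-injective (rule₁-column b _) (rule₁-column b′ _) e = cong suc (*-cancelˡ-≡ (1 + 2 * b) (1 + 2 * b′) 2 e)
last-row-key-injective (rule₁-column b _) (rule₂-column d′ _) e =
  contradiction (*-cancelˡ-≡ (1 + 2 * b) (2 + 2 * d′) 2 e) (1+2*a≢2+2*b b d′)
last-row-key-injective {c} (rule₂-column d _) last-column e =
  contradiction (sym e) (parity-≢ (isOdd[3+4*c] c) (isOdd[2*a] (2 + 2 * d)))
last-row-key-injective (rule₂-column d _) (odd-column b′ _) e = contradiction (sym e) (1+2*a≢2*b b′ (2 + 2 * d))
last-row-key-injective (rule₂-column d _) (rule₁-column b′ _) e =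
  contradiction (sym (*-cancelˡ-≡ (2 + 2 * d) (1 + 2 * b′) 2 e)) (1+2*a≢2+2*b b′ d)
last-row-key-injective {c} (rule₂-column d _) (rule₂-column d′ _) e = cong (λ x → 2 + 2 * (suc c + x)) d≡d′
  where
  d≡d′ = *-cancelˡ-≡ d d′ 2 (suc-injective (suc-injective (*-cancelˡ-≡ (2 + 2 * d) (2 + 2 * d′) 2 e)))

S-last-row-even : ∀ c b → 2 + 2 * b < 3 + 4 * c →
  S (4 + 4 * c) (3 + 4 * c) (2 + 2 * b) ≡ π (4 + 4 * c) (1 + 2 * b) (partner (4 + 4 * c) (1 + 2 * b) (4 + 4 * c))
S-last-row-even c b j<i = begin
  S n i j                ≡⟨ S-lower n j<i ⟩
  Supper n j i           ≡⟨ Supper-even n j i (isOdd[2+2*a] b) ⟩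
  Sodd n x (swap i)      ≡⟨ cong (Sodd n x) (swap-of-odd (isOdd[3+4*c] c)) ⟩
  Sodd n x n             ≡⟨ Sodd≡π∘partner {n} {x} {n} j<n (≢-sym (<⇒≢ (<-trans (n<1+n x) j<n))) ⟩
  π n x (partner n x n)  ∎
  where
  open ≡-Reasoning
  n = 4 + 4 * c
  i = 3 + 4 * c
  j = 2 + 2 * b
  x = 1 + 2 * b
  j<n : j < n
  j<n = <-trans j<i (n<1+n i)

S-last-row : ∀ c {j} (v : LastRowColumn c j) →
             S (4 + 4 * c) (3 + 4 * c) j ≡ π (4 + 4 * c) (3 + 4 * c) (last-row-key v)
S-last-row c last-column = begin
  S n i n       ≡⟨ S-upper n (n<1+n i) ⟩
  Supper n i n  ≡⟨ Supper-odd n i n (isOdd[3+4*c] c) ⟩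
  Sodd n i n    ≡⟨ Sodd-last-row n n ⟩
  3             ≡⟨ π-last-diagonal (4 * c) ⟨
  π n i i       ∎
  where
  open ≡-Reasoning
  n = 4 + 4 * c
  i = 3 + 4 * c
S-last-row c (odd-column b j<i) = S-below-odd {4 + 4 * c} {b = b} (isOdd[3+4*c] c) j<i (n<1+n (3 + 4 * c))
S-last-row c (rule₁-column b b≤c) with e , refl ← m≤n⇒∃[o]m+o≡n b≤c = begin
  S n i (2 + 2 * b)        ≡⟨ S-last-row-even (b + e) b j<i ⟩
  π n x (partner n x n)    ≡⟨ cong (π n x) (partner-last-rule₁ {n} {x} rule₁) ⟩
  π n x x                  ≡⟨ π-shift {2 + 4 * (b + e)} {x} {x} {i} {2 * x} x+x+i≡i+2x x+x+i≤2n ⟨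
  π n i (2 * x)            ∎
  where
  open ≡-Reasoning
  n = 4 + 4 * (b + e)
  i = 3 + 4 * (b + e)
  x = 1 + 2 * b
  j<i : 2 + 2 * b < 3 + 4 * (b + e)
  j<i = m+o≡n⇒m≤n (2 * b + 4 * e) (solve (b ∷ e ∷ []))
  rule₁ : 2 * (1 + 2 * b) < 4 + 4 * (b + e) + 1
  rule₁ = m+o≡n⇒m≤n (2 + 4 * e) (solve (b ∷ e ∷ []))
  x+x+i≡i+2x : 1 + 2 * b + (1 + 2 * b) + (3 + 4 * (b + e)) ≡ 3 + 4 * (b + e) + 2 * (1 + 2 * b)
  x+x+i≡i+2x = solve (b ∷ e ∷ [])
  x+x+i≤2n : 1 + 2 * b + (1 + 2 * b) + (3 + 4 * (b + e)) ≤ 4 + 4 * (b + e) + (4 + 4 * (b + e))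
  x+x+i≤2n = m+o≡n⇒m≤n (3 + 4 * e) (solve (b ∷ e ∷ []))
S-last-row c (rule₂-column d d<c) with e , refl ← m≤n⇒∃[o]m+o≡n d<c = begin
  S n i (1 + x)            ≡⟨ S-last-row-even (suc d + e) b j<i ⟩
  π n x (partner n x n)    ≡⟨ cong (π n x) (partner-last-rule₂ {n} {x} rule₂ x≢n (<⇒≢ 1+x<n)) ⟩
  π n x (suc x)            ≡⟨ π-cong {n} {x} {suc x} {i} {2 * (2 + 2 * d)} x+[1+x]≡i+key ⟩
  π n i (2 * (2 + 2 * d))  ∎
  where
  open ≡-Reasoning
  n = 4 + 4 * (suc d + e)
  i = 3 + 4 * (suc d + e)
  b = suc (suc d + e) + d
  x = 1 + 2 * b
  j<i : 2 + 2 * (suc (suc d + e) + d) < 3 + 4 * (suc d + e)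
  j<i = m+o≡n⇒m≤n (2 * e) (solve (d ∷ e ∷ []))
  1+x<n : 2 + 2 * (suc (suc d + e) + d) < 4 + 4 * (suc d + e)
  1+x<n = m+o≡n⇒m≤n (1 + 2 * e) (solve (d ∷ e ∷ []))
  x≢n = <⇒≢ (<-trans (n<1+n x) 1+x<n)
  rule₂ : 4 + 4 * (suc d + e) + 1 ≤ 2 * (1 + 2 * (suc (suc d + e) + d))
  rule₂ = m+o≡n⇒m≤n (1 + 4 * d) (solve (d ∷ e ∷ []))
  x+[1+x]≡i+key : 1 + 2 * (suc (suc d + e) + d) + (2 + 2 * (suc (suc d + e) + d)) ≡ 3 + 4 * (suc d + e) + 2 * (2 + 2 * d)
  x+[1+x]≡i+key = solve (d ∷ e ∷ [])

last-row-keys : ∀ c → RowKeys (4 + 4 * c) (3 + 4 * c)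
last-row-keys c = record
  { pivot         = 3 + 4 * c
  ; pivot≤n       = n≤1+n _
  ; key           = λ col → last-row-key (view col)
  ; key-bounds    = λ col → last-row-key-bounds (view col)
  ; key-injective = λ col col′ → last-row-key-injective (view col) (view col′)
  ; S≡π∘key       = λ col → S-last-row c (view col)
  }
  where
  view : ∀ {j} → Column (4 + 4 * c) (3 + 4 * c) j → LastRowColumn c j
  view = last-row-column c

odd-or-last-row-keys : ∀ c a → 1 + 2 * a ≤ 4 + 4 * c → RowKeys (4 + 4 * c) (1 + 2 * a)
odd-or-last-row-keys c a i≤n with 2 + 2 * a ≟ 4 + 4 * c
... | yes 1+i≡n = subst (RowKeys (4 + 4 * c)) (sym (suc-injective 1+i≡n)) (last-row-keys c)
... | no 1+i≢n  = odd-row-keys {a = a} (≤∧≢⇒< (≤∧≢⇒< i≤n i≢n) 1+i≢n)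
  where i≢n = parity-≢ (isOdd[1+2*a] a) (isOdd[4+4*c] c)

row-keys : ∀ c {i} → 1 ≤ i → i ≤ 4 + 4 * c → RowKeys (4 + 4 * c) i
row-keys c {suc i₀} _ i≤n with oddEven i₀
... | odd a  = odd-or-last-row-keys c a i≤n
... | even a = even-row-keys {a = a} (isOdd[4+4*c] c) (odd-or-last-row-keys c a (≤-trans (n≤1+n _) i≤n))

lemma3 : (k : ℕ) → 1 ≤ k → let n = 4 * k in
    (i : ℕ) → 1 ≤ i → i ≤ n →
      ((j : ℕ) → 1 ≤ j → j ≤ n → j ≢ i → 1 ≤ S n i j × S n i j ≤ n ∸ 1)
      × ((r : ℕ) → 1 ≤ r → r ≤ n ∸ 1 →
          Σ ℕ (λ j → (1 ≤ j × j ≤ n × j ≢ i × S n i j ≡ r)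
            × ((j′ : ℕ) → 1 ≤ j′ → j′ ≤ n → j′ ≢ i → S n i j′ ≡ r → j′ ≡ j)))
lemma3 zero    ()
lemma3 (suc c) _ = subst (λ n → ∀ i → 1 ≤ i → i ≤ n → PlaysEachRoundOnce n i) (sym (*-suc 4 c))
  λ i 1≤i i≤n → plays-each-round-once (row-keys c 1≤i i≤n)
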